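{- Let $\mathcal{K}$ be a non-degenerate coronoid with coronoid graph $G=G(\mathcal{K})$, and let $C$ be one of its perimeters, with binary boundary code $\mathit{BBC}(C)=2\,3^{\ell_1}\,2\,3^{\ell_2}\,2\cdots 2\,3^{\ell_d}$, where $\ell_i\ge 0$ for $i=1,\dots,d$. In the altan $A(G,C)$, for $1\le i\le d$ the $i$-th newly obtained face (the face bounded by the spokes at the $i$-th and $(i+1)$-th degree-2 vertices of $C$, indices modulo $d$, where the $i$-th degree-2 vertex is the $2$ immediately preceding the block $3^{\ell_i}$) has degree $\ell_i+5$. Moreover, the binary boundary code of the new boundary cycle is $(32)^d$.
   Context: Let $\mathcal{H}$ be the set of hexagons of the regular hexagonal tiling of the plane; two hexagons are adjacent if distinct and sharing an edge; a hexagonal system is a subset of $\mathcal{H}$; it is connected if non-empty and any two of its hexagons are joined by a sequence of its hexagons with consecutive ones adjacent. A coronoid is a finite connected hexagonal system $\mathcal{K}$; its corona holes are the finite connected components of $\mathcal{H}\setminus\mathcal{K}$; it is non-degenerate if no corona hole consists of a single hexagon. $G(\mathcal{K})$ is the subgraph of the hexagonal lattice consisting of all vertices and edges lying on some hexagon of $\mathcal{K}$. An edge of $G(\mathcal{K})$ is a boundary edge if it lies on exactly one hexagon of $\mathcal{K}$; a vertex is internal if incident with three edges each lying on two hexagons of $\mathcal{K}$, otherwise boundary. The boundary vertices and edges form disjoint cycles, the perimeters. The binary boundary code of a perimeter is the cyclic sequence of degrees in $G(\mathcal{K})$ of consecutive vertices along it (defined up to cyclic shift and reversal); $3^k$ denotes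 $k$ consecutive 3's. The altan $A(G,C)$: if $v_1,\dots,v_d$ are the degree-2 vertices of $C$ in cyclic order, add a new cycle $w_1x_1w_2x_2\cdots w_dx_dw_1$ on $2d$ new vertices and the spokes $v_iw_i$, the new cycle drawn in the hole bounded by $C$; the degrees in the new boundary code are taken in $A(G,C)$. -}

module Defs where

open import Data.Nat as ℕ using (ℕ; zero; suc; _+_; _∸_; _<ᵇ_; _≡ᵇ_; _≤_; _%_)
open import Data.Integer as ℤ using (ℤ; +_; ∣_∣)
open import Data.Product using (_×_; _,_; Σ; ∃)
open import Data.Bool using (Bool; true; false; if_then_else_; _∧_; _∨_)
open import Data.List using (List; []; _∷_; _++_; map; length; concat; concatMap; replicate; upTo)
open import Data.Bool.ListAction using (any)
open import Data.Nat.ListAction using (sum)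
open import Data.List.Membership.Propositional using (_∈_)
open import Data.List.Relation.Unary.All using (All)
open import Data.List.Relation.Unary.Unique.Propositional using (Unique)
open import Relation.Binary.PropositionalEquality using (_≡_; _≢_)
open import Relation.Nullary using (¬_; does)

-- The hexagonal lattice, in the "brick wall" model.
-- Lattice vertices are points (x , y) of ℤ²; every horizontal pair
-- (x , y) – (x+1 , y) is an edge, and (x , y) – (x , y+1) is an edge
-- iff x + y is even.  Every vertex has degree 3.
-- Hexagons (faces of the lattice) are indexed by (a , b) ∈ ℤ²; the
-- hexagon (a , b) is the brick with lower-left corner (2a+b , b).

Vertex : Set
Vertex = ℤ × ℤ

Hex : Set
Hex = ℤ × ℤ

_==ℤ_ : ℤ → ℤ → Bool
a ==ℤ b = does (a ℤ.≟ b)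

_==V_ : Vertex → Vertex → Bool
(a , b) ==V (c , d) = (a ==ℤ c) ∧ (b ==ℤ d)

evenℤ : ℤ → Bool
evenℤ z = (∣ z ∣ % 2) ≡ᵇ 0

hexVerts : Hex → List Vertex
hexVerts (a , b) =
  let x = (+ 2) ℤ.* a ℤ.+ b
      y = b
  in (x , y) ∷ (x ℤ.+ + 1 , y) ∷ (x ℤ.+ + 2 , y)
     ∷ (x ℤ.+ + 2 , y ℤ.+ + 1) ∷ (x ℤ.+ + 1 , y ℤ.+ + 1) ∷ (x , y ℤ.+ + 1) ∷ []

cycPairs : {A : Set} → List A → List (A × A)
cycPairs {A} [] = []
cycPairs {A} (c ∷ cs) = go (c ∷ cs)
  where
  go : List A → List (A × A)
  go [] = []
  go (a ∷ []) = (a , c) ∷ []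
  go (a ∷ b ∷ r) = (a , b) ∷ go (b ∷ r)

hexEdges : Hex → List (Vertex × Vertex)
hexEdges h = cycPairs (hexVerts h)

latticeNbrs : Vertex → List Vertex
latticeNbrs (x , y) =
  (x ℤ.+ + 1 , y) ∷ (x ℤ.- + 1 , y)
  ∷ (if evenℤ (x ℤ.+ y) then (x , y ℤ.+ + 1) else (x , y ℤ.- + 1)) ∷ []

edgeOnHex : Vertex → Vertex → Hex → Bool
edgeOnHex u v h = any (λ { (p , q) → ((u ==V p) ∧ (v ==V q)) ∨ ((u ==V q) ∧ (v ==V p)) }) (hexEdges h)

-- Hexagonal systems (finite ones are given by lists of hexagons;
-- only membership matters).

HexSystem : Set
HexSystem = List Hex

Adjacent : Hex → Hex → Set
Adjacent h h' = h ≢ h' × Σ Vertex λ u → Σ Vertex λ v → edgeOnHex u v h ≡ true × edgeOnHex u v h' ≡ true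

data Chain (S : HexSystem) : Hex → Hex → Set where
  here : ∀ {h} → Chain S h h
  step : ∀ {h k h'} → Adjacent h k → k ∈ S → Chain S k h' → Chain S h h'

Connected : HexSystem → Set
Connected S = S ≢ [] × (∀ h h' → h ∈ S → h' ∈ S → Chain S h h')

Coronoid : HexSystem → Set
Coronoid K = Connected K

-- S is a corona hole of K: a finite connected component of H \ K
CoronaHole : HexSystem → HexSystem → Set
CoronaHole K S =
  Connected S
  × (∀ h → h ∈ S → ¬ (h ∈ K))
  × (∀ h h' → h ∈ S → Adjacent h h' → ¬ (h' ∈ K) → h' ∈ S)

NonDegenerate : HexSystem → Set
NonDegenerate K = ∀ h → ¬ CoronaHole K (h ∷ [])

inG : HexSystem → Vertex → Vertex → Bool
inG K u v = any (edgeOnHex u v) K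

countB : {A : Set} → (A → Bool) → List A → ℕ
countB f xs = sum (map (λ a → if f a then 1 else 0) xs)

degG : HexSystem → Vertex → ℕ
degG K v = countB (inG K v) (latticeNbrs v)

BoundaryEdge : HexSystem → Vertex → Vertex → Set
BoundaryEdge K u v =
  Σ Hex λ h → h ∈ K × edgeOnHex u v h ≡ true
    × (∀ h' → h' ∈ K → edgeOnHex u v h' ≡ true → h' ≡ h)

Perimeter : HexSystem → List Vertex → Set
Perimeter K cs =
  3 ≤ length cs × Unique cs × All (λ { (u , v) → BoundaryEdge K u v }) (cycPairs cs)

bbcPattern : List ℕ → List ℕ
bbcPattern ℓs = concatMap (λ l → 2 ∷ replicate l 3) ℓs

data AVertex : Set where
  old : Vertex → AVertex
  w   : ℕ → AVertex     -- w i  (0-based)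
  x   : ℕ → AVertex     -- x i  (0-based)

_==A_ : AVertex → AVertex → Bool
old u ==A old v = u ==V v
w i ==A w j = i ≡ᵇ j
x i ==A x j = i ≡ᵇ j
_ ==A _ = false

nth : {A : Set} → A → List A → ℕ → A
nth d [] _ = d
nth d (a ∷ as) zero = a
nth d (a ∷ as) (suc k) = nth d as k

filterB : {A : Set} → (A → Bool) → List A → List A
filterB f [] = []
filterB f (a ∷ as) = if f a then a ∷ filterB f as else filterB f as

modN : ℕ → ℕ → ℕ
modN k zero = k
modN k (suc m) = k % suc m

dfltV : Vertex
dfltV = (+ 0 , + 0)

twoPos : HexSystem → List Vertex → List ℕ
twoPos K cs = filterB (λ k → degG K (nth dfltV cs k) ≡ᵇ 2) (upTo (length cs))

altanD : HexSystem → List Vertex → ℕ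
altanD K cs = length (twoPos K cs)

spokeV : HexSystem → List Vertex → ℕ → Vertex
spokeV K cs i = nth dfltV cs (nth 0 (twoPos K cs) i)

next : ℕ → ℕ → ℕ
next i d = if suc i <ᵇ d then suc i else 0

newEdges : HexSystem → List Vertex → List (AVertex × AVertex)
newEdges K cs =
  let d = altanD K cs in
  concatMap (λ i → (old (spokeV K cs i) , w i) ∷ (w i , x i) ∷ (x i , w (next i d)) ∷ [])
            (upTo d)

oldDeg : HexSystem → AVertex → ℕ
oldDeg K (old v) = degG K v
oldDeg K _ = 0

incid : AVertex → AVertex × AVertex → ℕ
incid u (p , q) = (if p ==A u then 1 else 0) + (if q ==A u then 1 else 0)

degA : HexSystem → List Vertex → AVertex → ℕ
degA K cs u = oldDeg K u + sum (map (incid u) (newEdges K cs))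

altanCycle : HexSystem → List Vertex → List AVertex
altanCycle K cs = concatMap (λ i → w i ∷ x i ∷ []) (upTo (altanD K cs))

faceWalk : HexSystem → List Vertex → ℕ → List AVertex
faceWalk K cs i =
  let ps = twoPos K cs
      d  = length ps
      n  = length cs
      a  = nth 0 ps i
      b  = if suc i <ᵇ d then nth 0 ps (suc i) else nth 0 ps 0 + n
  in map (λ k → old (nth dfltV cs (modN k n))) (map (λ j → a + j) (upTo (suc (b ∸ a))))
     ++ (w (next i d) ∷ x i ∷ w i ∷ [])

-- degree (number of edges = length of the closed boundary walk) of the i-th new face
faceDegree : HexSystem → List Vertex → ℕ → ℕ
faceDegree K cs i = length (faceWalk K cs i)

-- The degree-2 vertices of C sit at the starts of the blocks 2 3^ℓᵢ of its
-- boundary code, so consecutive ones lie ℓᵢ + 1 steps apart along C (cyclically).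
-- The i-th new face is bounded by those ℓᵢ + 2 vertices of C and by w_{i+1}, xᵢ, wᵢ,
-- hence has degree ℓᵢ + 5.  On the new cycle each xᵢ meets only wᵢ and w_{i+1},
-- while each wᵢ also carries its spoke, which gives the code (32)^d.
module Submission where

open import Defs
open import Algebra.Properties.CommutativeSemigroup using (interchange)
open import Data.Bool using (Bool; true; false; if_then_else_)
open import Data.Empty using (⊥-elim)
open import Data.Fin using (fromℕ<)
open import Data.List using (List; _∷_; []; map; length; concat; replicate; lookup; _++_; _∷ʳ_; concatMap; applyUpTo; upTo)
open import Data.List.Properties using (length-map; length-++; length-replicate; length-upTo; map-++; map-∘; map-cong; map-cong-local; map-upTo; upTo-∷ʳ)
open import Data.List.Relation.Binary.Permutation.Propositional using (_↭_; ↭-refl; module PermutationReasoning)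
open import Data.List.Relation.Binary.Permutation.Propositional.Properties using (map⁺; ∷↭∷ʳ)
open import Data.List.Relation.Unary.All using (All; []; _∷_)
open import Data.List.Relation.Unary.All.Properties using (applyUpTo⁺₁)
open import Data.Nat using (ℕ; zero; suc; _+_; _∸_; _≤_; _<_; _<ᵇ_; _≡ᵇ_; s<s)
open import Data.Nat.ListAction using (sum)
open import Data.Nat.ListAction.Properties using (sum-++; sum-↭)
open import Data.Nat.Properties using (+-identityʳ; +-suc; +-assoc; +-comm; +-commutativeSemigroup; suc-injective; <⇒<ᵇ; <ᵇ⇒<; <⇒≱; ≤-refl; ≤-reflexive; m≤n⇒m<n∨m≡n; m+n∸m≡n)
open import Data.Product using (_×_; _,_)
open import Data.Sum using (inj₁; inj₂)
open import Function using (_∘_)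
open import Relation.Binary.PropositionalEquality using (_≡_; refl; sym; trans; cong; cong₂; subst; module ≡-Reasoning)

if-<ᵇ-true : ∀ {A : Set} {m n} (a b : A) → m < n → (if m <ᵇ n then a else b) ≡ a
if-<ᵇ-true {m = m} {n} a b m<n with m <ᵇ n | <⇒<ᵇ m<n
... | true | _ = refl

if-<ᵇ-false : ∀ {A : Set} {m n} (a b : A) → n ≤ m → (if m <ᵇ n then a else b) ≡ b
if-<ᵇ-false {m = m} {n} a b n≤m with m <ᵇ n | <ᵇ⇒< m n
... | false | _ = refl
... | true | m<n = ⊥-elim (<⇒≱ (m<n _) n≤m)

lookup-fromℕ< : ∀ {A : Set} (e : A) (ys : List A) {i} (i<n : i < length ys) → lookup ys (fromℕ< i<n) ≡ nth e ys i
lookup-fromℕ< e (y ∷ ys) {zero} _ = refl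
lookup-fromℕ< e (y ∷ ys) {suc i} (s<s i<n) = lookup-fromℕ< e ys i<n

sum-map-+ : ∀ {A : Set} (f g : A → ℕ) ys → sum (map (λ a → f a + g a) ys) ≡ sum (map f ys) + sum (map g ys)
sum-map-+ f g [] = refl
sum-map-+ f g (y ∷ ys) = trans (cong (f y + g y +_) (sum-map-+ f g ys)) (interchange +-commutativeSemigroup (f y) (g y) _ _)

sum-map-concatMap : ∀ {A B : Set} (f : B → ℕ) (g : A → List B) ys →
  sum (map f (concatMap g ys)) ≡ sum (map (λ a → sum (map f (g a))) ys)
sum-map-concatMap f g [] = refl
sum-map-concatMap f g (y ∷ ys) = begin
  sum (map f (g y ++ concatMap g ys))               ≡⟨ cong sum (map-++ f (g y) _) ⟩
  sum (map f (g y) ++ map f (concatMap g ys))       ≡⟨ sum-++ (map f (g y)) _ ⟩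
  sum (map f (g y)) + sum (map f (concatMap g ys))  ≡⟨ cong (sum (map f (g y)) +_) (sum-map-concatMap f g ys) ⟩
  sum (map f (g y)) + sum (map (λ a → sum (map f (g a))) ys) ∎
  where open ≡-Reasoning

map-concatMap-const : ∀ {A B C : Set} (f : B → C) (g : A → List B) (c : List C) {ys} →
  All (λ a → map f (g a) ≡ c) ys → map f (concatMap g ys) ≡ concat (replicate (length ys) c)
map-concatMap-const f g c [] = refl
map-concatMap-const f g c {y ∷ ys} (gy≡c ∷ gys≡c) =
  trans (map-++ f (g y) _) (cong₂ _++_ gy≡c (map-concatMap-const f g c gys≡c))

filterB-map : ∀ {A B : Set} (p : B → Bool) (f : A → B) ys → filterB p (map f ys) ≡ map f (filterB (p ∘ f) ys)
filterB-map p f [] = refl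
filterB-map p f (y ∷ ys) with p (f y)
... | true  = cong (f y ∷_) (filterB-map p f ys)
... | false = filterB-map p f ys

indicesFrom : ∀ {A : Set} → (A → Bool) → ℕ → List A → List ℕ
indicesFrom p o [] = []
indicesFrom p o (y ∷ ys) = if p y then o ∷ indicesFrom p (suc o) ys else indicesFrom p (suc o) ys

indicesFrom-suc : ∀ {A : Set} (p : A → Bool) o ys → indicesFrom p (suc o) ys ≡ map suc (indicesFrom p o ys)
indicesFrom-suc p o [] = refl
indicesFrom-suc p o (y ∷ ys) with p y
... | true  = cong (suc o ∷_) (indicesFrom-suc p (suc o) ys)
... | false = indicesFrom-suc p (suc o) ys

indicesFrom-map : ∀ {A B : Set} (p : B → Bool) (f : A → B) o ys → indicesFrom (p ∘ f) o ys ≡ indicesFrom p o (map f ys)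
indicesFrom-map p f o [] = refl
indicesFrom-map p f o (y ∷ ys) = cong (λ is → if p (f y) then o ∷ is else is) (indicesFrom-map p f (suc o) ys)

filterB-upTo-nth : ∀ {A : Set} (p : A → Bool) (e : A) ys →
  filterB (λ k → p (nth e ys k)) (upTo (length ys)) ≡ indicesFrom p 0 ys
filterB-upTo-nth p e [] = refl
filterB-upTo-nth p e (y ∷ ys) = cong (λ is → if p y then 0 ∷ is else is) (begin
  filterB (λ k → p (nth e (y ∷ ys) k)) (applyUpTo suc (length ys))   ≡⟨ cong (filterB _) (map-upTo suc (length ys)) ⟨
  filterB (λ k → p (nth e (y ∷ ys) k)) (map suc (upTo (length ys)))  ≡⟨ filterB-map _ suc (upTo (length ys)) ⟩
  map suc (filterB (λ k → p (nth e ys k)) (upTo (length ys)))        ≡⟨ cong (map suc) (filterB-upTo-nth p e ys) ⟩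
  map suc (indicesFrom p 0 ys)                                        ≡⟨ indicesFrom-suc p 0 ys ⟨
  indicesFrom p 1 ys                                                  ∎)
  where open ≡-Reasoning

indicesFrom-replicate-++ : ∀ {A : Set} (p : A → Bool) {a} → p a ≡ false →
  ∀ o l ys → indicesFrom p o (replicate l a ++ ys) ≡ indicesFrom p (o + l) ys
indicesFrom-replicate-++ p pa≡false o zero ys = cong (λ o → indicesFrom p o ys) (sym (+-identityʳ o))
indicesFrom-replicate-++ p pa≡false o (suc l) ys rewrite pa≡false =
  trans (indicesFrom-replicate-++ p pa≡false (suc o) l ys) (cong (λ o → indicesFrom p o ys) (sym (+-suc o l)))

blockStarts : ℕ → List ℕ → List ℕ
blockStarts o [] = []
blockStarts o (l ∷ ls) = o ∷ blockStarts (o + suc l) ls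

length-blockStarts : ∀ o ls → length (blockStarts o ls) ≡ length ls
length-blockStarts o [] = refl
length-blockStarts o (l ∷ ls) = cong suc (length-blockStarts (o + suc l) ls)

length-bbcPattern : ∀ ls → length (bbcPattern ls) ≡ sum (map suc ls)
length-bbcPattern [] = refl
length-bbcPattern (l ∷ ls) =
  cong suc (trans (length-++ (replicate l 3)) (cong₂ _+_ (length-replicate l) (length-bbcPattern ls)))

indicesFrom-bbcPattern : ∀ o ls → indicesFrom (_≡ᵇ 2) o (bbcPattern ls) ≡ blockStarts o ls
indicesFrom-bbcPattern o [] = refl
indicesFrom-bbcPattern o (l ∷ ls) = cong (o ∷_) (begin
  indicesFrom (_≡ᵇ 2) (suc o) (replicate l 3 ++ bbcPattern ls)  ≡⟨ indicesFrom-replicate-++ (_≡ᵇ 2) refl (suc o) l _ ⟩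
  indicesFrom (_≡ᵇ 2) (suc (o + l)) (bbcPattern ls)            ≡⟨ cong (λ o′ → indicesFrom (_≡ᵇ 2) o′ (bbcPattern ls)) (+-suc o l) ⟨
  indicesFrom (_≡ᵇ 2) (o + suc l) (bbcPattern ls)              ≡⟨ indicesFrom-bbcPattern (o + suc l) ls ⟩
  blockStarts (o + suc l) ls                                   ∎)
  where open ≡-Reasoning

blockStarts-suc : ∀ o ls {i} → suc i < length ls →
  nth 0 (blockStarts o ls) (suc i) ≡ nth 0 (blockStarts o ls) i + suc (nth 0 ls i)
blockStarts-suc o (l ∷ l′ ∷ ls) {zero} _ = refl
blockStarts-suc o (l ∷ ls) {suc i} (s<s i<n) = blockStarts-suc (o + suc l) ls i<n

blockStarts-last : ∀ o ls {i} → suc i ≡ length ls →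
  o + sum (map suc ls) ≡ nth 0 (blockStarts o ls) i + suc (nth 0 ls i)
blockStarts-last o (l ∷ []) {zero} _ = cong (o +_) (+-identityʳ (suc l))
blockStarts-last o (l ∷ l′ ∷ ls) {suc i} i≡n =
  trans (sym (+-assoc o (suc l) _)) (blockStarts-last (o + suc l) (l′ ∷ ls) (suc-injective i≡n))

twoPos-bbcPattern : ∀ K cs ℓs → map (degG K) cs ≡ bbcPattern ℓs → twoPos K cs ≡ blockStarts 0 ℓs
twoPos-bbcPattern K cs ℓs degs≡bbc = begin
  twoPos K cs                                        ≡⟨ filterB-upTo-nth (λ v → degG K v ≡ᵇ 2) dfltV cs ⟩
  indicesFrom (λ v → degG K v ≡ᵇ 2) 0 cs             ≡⟨ indicesFrom-map (_≡ᵇ 2) (degG K) 0 cs ⟩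
  indicesFrom (_≡ᵇ 2) 0 (map (degG K) cs)            ≡⟨ cong (indicesFrom (_≡ᵇ 2) 0) degs≡bbc ⟩
  indicesFrom (_≡ᵇ 2) 0 (bbcPattern ℓs)              ≡⟨ indicesFrom-bbcPattern 0 ℓs ⟩
  blockStarts 0 ℓs                                   ∎
  where open ≡-Reasoning

altanD-bbcPattern : ∀ K cs ℓs → map (degG K) cs ≡ bbcPattern ℓs → altanD K cs ≡ length ℓs
altanD-bbcPattern K cs ℓs degs≡bbc = trans (cong length (twoPos-bbcPattern K cs ℓs degs≡bbc)) (length-blockStarts 0 ℓs)

-- The position on C, counted past the end when the face wraps around, of the
-- degree-2 vertex closing the i-th new face: the bound b in faceWalk.
faceEnd : List ℕ → ℕ → ℕ → ℕ
faceEnd ps n i = if suc i <ᵇ length ps then nth 0 ps (suc i) else nth 0 ps 0 + n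

faceDegree-faceEnd : ∀ K cs i →
  faceDegree K cs i ≡ suc (faceEnd (twoPos K cs) (length cs) i ∸ nth 0 (twoPos K cs) i) + 3
faceDegree-faceEnd K cs i =
  trans (length-++ (map vertexOfC (map (a +_) (upTo m))))
        (cong (_+ 3) (trans (length-map vertexOfC (map (a +_) (upTo m))) (trans (length-map (a +_) (upTo m)) (length-upTo m))))
  where
  a m : ℕ
  a = nth 0 (twoPos K cs) i
  m = suc (faceEnd (twoPos K cs) (length cs) i ∸ a)
  vertexOfC : ℕ → AVertex
  vertexOfC k = old (nth dfltV cs (modN k (length cs)))

faceEnd-blockStarts : ∀ ℓs {i} → i < length ℓs →
  faceEnd (blockStarts 0 ℓs) (sum (map suc ℓs)) i ≡ nth 0 (blockStarts 0 ℓs) i + suc (nth 0 ℓs i)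
faceEnd-blockStarts ℓs@(_ ∷ _) {i} i<n with m≤n⇒m<n∨m≡n i<n
... | inj₁ 1+i<n = trans (if-<ᵇ-true _ _ (subst (suc i <_) (sym (length-blockStarts 0 ℓs)) 1+i<n))
                         (blockStarts-suc 0 ℓs 1+i<n)
... | inj₂ 1+i≡n = trans (if-<ᵇ-false _ _ (≤-reflexive (trans (length-blockStarts 0 ℓs) (sym 1+i≡n))))
                         (blockStarts-last 0 ℓs 1+i≡n)

faceDegree-bbcPattern : ∀ K cs ℓs → map (degG K) cs ≡ bbcPattern ℓs →
  ∀ {i} → i < length ℓs → faceDegree K cs i ≡ nth 0 ℓs i + 5
faceDegree-bbcPattern K cs ℓs degs≡bbc {i} i<d = begin
  faceDegree K cs i                                       ≡⟨ faceDegree-faceEnd K cs i ⟩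
  suc (faceEnd ps (length cs) i ∸ nth 0 ps i) + 3         ≡⟨ cong₂ (λ ps n → suc (faceEnd ps n i ∸ nth 0 ps i) + 3) ps≡ n≡ ⟩
  suc (faceEnd bs (sum (map suc ℓs)) i ∸ nth 0 bs i) + 3  ≡⟨ cong (λ e → suc (e ∸ nth 0 bs i) + 3) (faceEnd-blockStarts ℓs i<d) ⟩
  suc (nth 0 bs i + suc ℓ ∸ nth 0 bs i) + 3               ≡⟨ cong (λ e → suc e + 3) (m+n∸m≡n (nth 0 bs i) (suc ℓ)) ⟩
  suc (suc ℓ) + 3                                         ≡⟨ trans (+-comm (suc (suc ℓ)) 3) (+-comm 5 ℓ) ⟩
  ℓ + 5                                                   ∎
  where
  open ≡-Reasoning
  ps bs : List ℕ
  ps = twoPos K cs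
  bs = blockStarts 0 ℓs
  ℓ : ℕ
  ℓ = nth 0 ℓs i
  ps≡ : ps ≡ bs
  ps≡ = twoPos-bbcPattern K cs ℓs degs≡bbc
  n≡ : length cs ≡ sum (map suc ℓs)
  n≡ = trans (sym (length-map (degG K) cs)) (trans (cong length degs≡bbc) (length-bbcPattern ℓs))

indicator : ℕ → ℕ → ℕ
indicator i j = if j ≡ᵇ i then 1 else 0

occurrences : ℕ → List ℕ → ℕ
occurrences i js = sum (map (indicator i) js)

occurrences-zero-map-suc : ∀ js → occurrences 0 (map suc js) ≡ 0
occurrences-zero-map-suc [] = refl
occurrences-zero-map-suc (j ∷ js) = occurrences-zero-map-suc js

occurrences-suc-map-suc : ∀ i js → occurrences (suc i) (map suc js) ≡ occurrences i js
occurrences-suc-map-suc i js = cong sum (sym (map-∘ js))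

occurrences-upTo : ∀ {i d} → i < d → occurrences i (upTo d) ≡ 1
occurrences-upTo {zero} {suc d} _ =
  cong (1 +_) (trans (cong (occurrences 0) (sym (map-upTo suc d))) (occurrences-zero-map-suc (upTo d)))
occurrences-upTo {suc i} {suc d} (s<s i<d) = begin
  occurrences (suc i) (applyUpTo suc d)       ≡⟨ cong (occurrences (suc i)) (map-upTo suc d) ⟨
  occurrences (suc i) (map suc (upTo d))      ≡⟨ occurrences-suc-map-suc i (upTo d) ⟩
  occurrences i (upTo d)                      ≡⟨ occurrences-upTo i<d ⟩
  1                                           ∎
  where open ≡-Reasoning

map-next-upTo : ∀ d → map (λ j → next j (suc d)) (upTo (suc d)) ≡ map suc (upTo d) ∷ʳ 0
map-next-upTo d = begin
  map (λ j → next j (suc d)) (upTo (suc d))               ≡⟨ cong (map (λ j → next j (suc d))) (upTo-∷ʳ d) ⟨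
  map (λ j → next j (suc d)) (upTo d ∷ʳ d)                ≡⟨ map-++ (λ j → next j (suc d)) (upTo d) (d ∷ []) ⟩
  map (λ j → next j (suc d)) (upTo d) ∷ʳ next d (suc d)   ≡⟨ cong₂ _∷ʳ_ (map-cong-local below-d) (if-<ᵇ-false {m = d} (suc d) 0 ≤-refl) ⟩
  map suc (upTo d) ∷ʳ 0                                   ∎
  where
  open ≡-Reasoning
  below-d : All (λ j → next j (suc d) ≡ suc j) (upTo d)
  below-d = applyUpTo⁺₁ _ d (λ j<d → if-<ᵇ-true _ _ (s<s j<d))

map-next-upTo-↭ : ∀ d → map (λ j → next j d) (upTo d) ↭ upTo d
map-next-upTo-↭ zero = ↭-refl
map-next-upTo-↭ (suc d) = begin
  map (λ j → next j (suc d)) (upTo (suc d))  ≡⟨ map-next-upTo d ⟩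
  map suc (upTo d) ∷ʳ 0                      ↭⟨ ∷↭∷ʳ 0 (map suc (upTo d)) ⟨
  0 ∷ map suc (upTo d)                       ≡⟨ cong (0 ∷_) (map-upTo suc d) ⟩
  upTo (suc d)                               ∎
  where open PermutationReasoning

occurrences-next-upTo : ∀ {i d} → i < d → occurrences i (map (λ j → next j d) (upTo d)) ≡ 1
occurrences-next-upTo {i} {d} i<d =
  trans (sum-↭ (map⁺ (indicator i) (map-next-upTo-↭ d))) (occurrences-upTo i<d)

-- newEdges K cs unfolds to concatMap (newEdgesAt K cs) (upTo (altanD K cs)).
newEdgesAt : HexSystem → List Vertex → ℕ → List (AVertex × AVertex)
newEdgesAt K cs j = (old (spokeV K cs j) , w j) ∷ (w j , x j) ∷ (x j , w (next j (altanD K cs))) ∷ []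

degA-w : ∀ K cs {i} → i < altanD K cs → degA K cs (w i) ≡ 3
degA-w K cs {i} i<d = begin
  sum (map (incid (w i)) (newEdges K cs))                                ≡⟨ sum-map-concatMap (incid (w i)) _ (upTo d) ⟩
  sum (map (λ j → sum (map (incid (w i)) (newEdgesAt K cs j))) (upTo d)) ≡⟨ cong sum (map-cong incidences (upTo d)) ⟩
  sum (map (λ j → indicator i j + (indicator i j + indicator i (next j d))) (upTo d))
    ≡⟨ trans (sum-map-+ (indicator i) _ (upTo d)) (cong (occurrences i (upTo d) +_) (sum-map-+ (indicator i) _ (upTo d))) ⟩
  occurrences i (upTo d) + (occurrences i (upTo d) + sum (map (indicator i ∘ λ j → next j d) (upTo d)))
    ≡⟨ cong (λ n → occurrences i (upTo d) + (occurrences i (upTo d) + sum n)) (map-∘ (upTo d)) ⟩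
  occurrences i (upTo d) + (occurrences i (upTo d) + occurrences i (map (λ j → next j d) (upTo d)))
    ≡⟨ cong₂ _+_ (occurrences-upTo i<d) (cong₂ _+_ (occurrences-upTo i<d) (occurrences-next-upTo i<d)) ⟩
  3                                                                      ∎
  where
  open ≡-Reasoning
  d : ℕ
  d = altanD K cs
  incidences : ∀ j → sum (map (incid (w i)) (newEdgesAt K cs j)) ≡ indicator i j + (indicator i j + indicator i (next j d))
  incidences j = cong₂ (λ a b → indicator i j + (a + b)) (+-identityʳ (indicator i j)) (+-identityʳ _)

degA-x : ∀ K cs {i} → i < altanD K cs → degA K cs (x i) ≡ 2
degA-x K cs {i} i<d = begin
  sum (map (incid (x i)) (newEdges K cs))                                ≡⟨ sum-map-concatMap (incid (x i)) _ (upTo d) ⟩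
  sum (map (λ j → sum (map (incid (x i)) (newEdgesAt K cs j))) (upTo d)) ≡⟨ cong sum (map-cong incidences (upTo d)) ⟩
  sum (map (λ j → indicator i j + indicator i j) (upTo d))               ≡⟨ sum-map-+ (indicator i) (indicator i) (upTo d) ⟩
  occurrences i (upTo d) + occurrences i (upTo d)                        ≡⟨ cong₂ _+_ (occurrences-upTo i<d) (occurrences-upTo i<d) ⟩
  2                                                                      ∎
  where
  open ≡-Reasoning
  d : ℕ
  d = altanD K cs
  incidences : ∀ j → sum (map (incid (x i)) (newEdgesAt K cs j)) ≡ indicator i j + indicator i j
  incidences j = cong (indicator i j +_) (trans (+-identityʳ _) (+-identityʳ _))

degA-altanCycle : ∀ K cs → map (degA K cs) (altanCycle K cs) ≡ concat (replicate (altanD K cs) (3 ∷ 2 ∷ []))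
degA-altanCycle K cs =
  trans (map-concatMap-const (degA K cs) (λ i → w i ∷ x i ∷ []) (3 ∷ 2 ∷ []) degrees)
        (cong (λ n → concat (replicate n (3 ∷ 2 ∷ []))) (length-upTo (altanD K cs)))
  where
  degrees : All (λ i → map (degA K cs) (w i ∷ x i ∷ []) ≡ 3 ∷ 2 ∷ []) (upTo (altanD K cs))
  degrees = applyUpTo⁺₁ _ (altanD K cs) (λ i<d → cong₂ _∷_ (degA-w K cs i<d) (cong (_∷ []) (degA-x K cs i<d)))

theorem5p2 : (K : HexSystem) → Coronoid K → NonDegenerate K →
    (cs : List Vertex) → Perimeter K cs →
    (ℓs : List ℕ) → map (degG K) cs ≡ bbcPattern ℓs →
    ((i : ℕ) (i<d : i < length ℓs) → faceDegree K cs i ≡ lookup ℓs (fromℕ< i<d) + 5)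
    × map (degA K cs) (altanCycle K cs) ≡ concat (replicate (length ℓs) (3 ∷ 2 ∷ []))
theorem5p2 K _ _ cs _ ℓs degs≡bbc = faceDegrees , cycleCode
  where
  faceDegrees : (i : ℕ) (i<d : i < length ℓs) → faceDegree K cs i ≡ lookup ℓs (fromℕ< i<d) + 5
  faceDegrees i i<d =
    trans (faceDegree-bbcPattern K cs ℓs degs≡bbc i<d) (cong (_+ 5) (sym (lookup-fromℕ< 0 ℓs i<d)))
  cycleCode : map (degA K cs) (altanCycle K cs) ≡ concat (replicate (length ℓs) (3 ∷ 2 ∷ []))
  cycleCode = trans (degA-altanCycle K cs)
                    (cong (λ d → concat (replicate d (3 ∷ 2 ∷ []))) (altanD-bbcPattern K cs ℓs degs≡bbc))
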